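{- Let $n$ be a positive integer and let $V_p(\Lambda_n)$ be the set of primitive Lucas strings of length $n$. (i) The sets ${\rm Fix}_j=\{u\in V_p(\Lambda_n);\ \alpha^j\beta(u)=u\}$, $j\in\{0,1,\ldots,n-1\}$, are pairwise disjoint. (ii) $s_n=t_n$, where $s_n$ is the number of Lucas strings of length $n$ that are primitive and symmetric and $t_n=\sum_{j=0}^{n-1}|{\rm Fix}_j|$.
   Context: A Lucas string of length $n$ is a binary string $u_1\cdots u_n$ with no two consecutive 1s and not both $u_1=1$ and $u_n=1$. For $u=u_1\cdots u_n$, $\alpha(u)=u_nu_1\cdots u_{n-1}$ and $\beta(u)=u_n\cdots u_1$; $\bar u$ is the orbit of $u$ under the group generated by $\alpha,\beta$. $u$ is symmetric if $|\bar u|<2n$; $u$ is primitive if there is no nonempty $v$ and $k\ge 2$ with $u=v^k$. -}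

module Defs where

open import Data.Bool using (Bool; true; false) renaming (_≟_ to _≟ᵇ_)
open import Data.Nat using (ℕ; zero; suc; _+_; _*_; _≤_; _<_; s≤s; z≤n)
open import Data.Nat.Properties using (≤-trans; ≤-refl; m≤m+n; *-monoʳ-≤; *-monoˡ-≤; *-identityʳ; *-identityˡ; _≤?_)
open import Data.List using (List; []; _∷_; [_]; _++_; map; concat; replicate; length; reverse; filter; upTo; head; last)
open import Data.List.Properties using (≡-dec; length-++)
open import Data.List.Membership.Propositional using (_∈_; lose)
open import Data.List.Membership.Propositional.Properties using (∈-++⁺ˡ; ∈-++⁺ʳ; ∈-map⁺; ∈-upTo⁺)
open import Data.List.Relation.Unary.Any using (Any; any?; satisfied)
open import Data.Maybe using (Maybe; just; nothing)
open import Data.Maybe.Properties using () renaming (≡-dec to ≡-decᴹ)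
open import Data.Empty using (⊥)
open import Data.Unit using (⊤; tt)
open import Data.Product using (Σ; ∃; _×_; _,_; proj₁; proj₂)
open import Data.Product.Properties using ()
open import Relation.Nullary using (¬_; Dec; yes; no)
open import Relation.Nullary.Decidable using (_×-dec_; ¬?)
open import Relation.Binary.PropositionalEquality using (_≡_; _≢_; refl; sym; trans; cong; subst)
open import Data.List.Extrema.Nat using ()
import Data.List.Extrema
open import Data.List using (deduplicate)
open import Data.Nat.ListAction using (sum)

-- Binary strings u = u₁ ⋯ uₙ are lists of booleans (true = 1, false = 0).
Str : Set
Str = List Bool

_≟ˢ_ : (u v : Str) → Dec (u ≡ v)
_≟ˢ_ = ≡-dec _≟ᵇ_

NoConsecutiveOnes : Str → Set
NoConsecutiveOnes []                   = ⊤
NoConsecutiveOnes (x ∷ [])             = ⊤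
NoConsecutiveOnes (true ∷ true ∷ xs)   = ⊥
NoConsecutiveOnes (true ∷ false ∷ xs)  = NoConsecutiveOnes (false ∷ xs)
NoConsecutiveOnes (false ∷ y ∷ xs)     = NoConsecutiveOnes (y ∷ xs)

noConsecutiveOnes? : (u : Str) → Dec (NoConsecutiveOnes u)
noConsecutiveOnes? []                  = yes tt
noConsecutiveOnes? (x ∷ [])            = yes tt
noConsecutiveOnes? (true ∷ true ∷ xs)  = no λ ()
noConsecutiveOnes? (true ∷ false ∷ xs) = noConsecutiveOnes? (false ∷ xs)
noConsecutiveOnes? (false ∷ y ∷ xs)    = noConsecutiveOnes? (y ∷ xs)

IsLucas : Str → Set
IsLucas u = NoConsecutiveOnes u × ¬ (head u ≡ just true × last u ≡ just true)

isLucas? : (u : Str) → Dec (IsLucas u)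
isLucas? u = noConsecutiveOnes? u
  ×-dec ¬? (≡-decᴹ _≟ᵇ_ (head u) (just true) ×-dec ≡-decᴹ _≟ᵇ_ (last u) (just true))

α : Str → Str
α u with Data.List.unsnoc u
... | nothing        = []
... | just (xs , x)  = x ∷ xs

β : Str → Str
β = reverse

_^[_] : (Str → Str) → ℕ → Str → Str
(f ^[ zero ])  u = u
(f ^[ suc j ]) u = f ((f ^[ j ]) u)

-- The group generated by α and β acting on strings of length n ≥ 1 is
-- {αʲ, αʲβ ; 0 ≤ j < n}; the orbit ū is the list of images, duplicates removed.
orbit : Str → List Str
orbit u = deduplicate _≟ˢ_
  (map (λ j → (α ^[ j ]) u) (upTo (length u)) ++ map (λ j → (α ^[ j ]) (β u)) (upTo (length u)))

orbitSize : Str → ℕ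
orbitSize u = length (orbit u)

Symmetric : Str → Set
Symmetric u = orbitSize u < 2 * length u

symmetric? : (u : Str) → Dec (Symmetric u)
symmetric? u = suc (orbitSize u) ≤? 2 * length u

_^^_ : Str → ℕ → Str
v ^^ k = concat (replicate k v)

Primitive : Str → Set
Primitive u = ∀ (v : Str) (k : ℕ) → v ≢ [] → 2 ≤ k → u ≢ v ^^ k

allStrings : ℕ → List Str
allStrings zero    = [ [] ]
allStrings (suc n) = map (false ∷_) (allStrings n) ++ map (true ∷_) (allStrings n)

allStrings-complete : (u : Str) → u ∈ allStrings (length u)
allStrings-complete []          = Any.here refl
  where import Data.List.Relation.Unary.Any as Any
allStrings-complete (false ∷ u) = ∈-++⁺ˡ (∈-map⁺ (false ∷_) (allStrings-complete u))
allStrings-complete (true ∷ u)  = ∈-++⁺ʳ _ (∈-map⁺ (true ∷_) (allStrings-complete u))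

length-^^ : (v : Str) (k : ℕ) → length (v ^^ k) ≡ k * length v
length-^^ v zero    = refl
length-^^ v (suc k) = trans (length-++ v) (cong (length v +_) (length-^^ v k))

private
  Witness : Str → ℕ → Str → ℕ → Set
  Witness u m v k = v ≢ [] × 2 ≤ k × u ≡ v ^^ k

  Bad : Str → Set
  Bad u = Any (λ m → Any (λ v → Any (λ k → Witness u m v k) (upTo (suc (length u))))
                         (allStrings m))
              (upTo (suc (length u)))

  witness? : ∀ u m v k → Dec (Witness u m v k)
  witness? u m v k = ¬? (v ≟ˢ []) ×-dec (2 ≤? k) ×-dec (u ≟ˢ (v ^^ k))

  bad? : ∀ u → Dec (Bad u)
  bad? u = any? (λ m → any? (λ v → any? (λ k → witness? u m v k) _) _) _

  nonempty : (v : Str) → v ≢ [] → 1 ≤ length v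
  nonempty []      ne = Data.Empty.⊥-elim (ne refl)
    where import Data.Empty
  nonempty (x ∷ v) ne = s≤s z≤n

  prim→¬bad : ∀ u → Primitive u → ¬ Bad u
  prim→¬bad u p b with satisfied b
  ... | m , b₁ with satisfied b₁
  ... | v , b₂ with satisfied b₂
  ... | k , (ne , 2≤k , eq) = p v k ne 2≤k eq

  ¬bad→prim : ∀ u → ¬ Bad u → Primitive u
  ¬bad→prim u nb v k ne 2≤k eq = nb
      (lose
        m∈ (lose
              (allStrings-complete v) (lose
                 k∈ (ne , 2≤k , eq))))
    where
    len : length u ≡ k * length v
    len = trans (cong length eq) (length-^^ v k)
    lv≤ : length v ≤ length u
    lv≤ = subst (length v ≤_) (sym len)
            (subst (_≤ k * length v) (*-identityˡ (length v))
              (*-monoˡ-≤ (length v) (≤-trans (s≤s z≤n) 2≤k)))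
    k≤ : k ≤ length u
    k≤ = subst (k ≤_) (sym len)
            (subst (_≤ k * length v) (*-identityʳ k) (*-monoʳ-≤ k (nonempty v ne)))
    m∈ : length v ∈ upTo (suc (length u))
    m∈ = ∈-upTo⁺ (s≤s lv≤)
    k∈ : k ∈ upTo (suc (length u))
    k∈ = ∈-upTo⁺ (s≤s k≤)

primitive? : (u : Str) → Dec (Primitive u)
primitive? u with bad? u
... | yes b = no (λ p → prim→¬bad u p b)
... | no nb = yes (¬bad→prim u nb)

IsPrimLucas : Str → Set
IsPrimLucas u = IsLucas u × Primitive u

isPrimLucas? : (u : Str) → Dec (IsPrimLucas u)
isPrimLucas? u = isLucas? u ×-dec primitive? u

Vp : ℕ → List Str
Vp n = filter isPrimLucas? (allStrings n)

Fix : ℕ → ℕ → List Str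
Fix n j = filter (λ u → ((α ^[ j ]) (β u)) ≟ˢ u) (Vp n)

s : ℕ → ℕ
s n = length (filter (λ u → isPrimLucas? u ×-dec symmetric? u) (allStrings n))

t : ℕ → ℕ
t n = sum (map (λ j → length (Fix n j)) (upTo n))

module Submission where

-- Corollary 5.5.  For a primitive string u of length n, u is symmetric iff
-- αʲβ(u) = u for some j < n, and that j is then unique.  Uniqueness is
-- part (i); summing the resulting partition over all strings gives (ii).
--
--  * Rotations: αᵏ(x ++ y) = y ++ x for k = |y|, so αⁿ fixes strings of
--    length n and αᵏ only depends on k mod n.
--  * Lyndon–Schützenberger: commuting words are powers of a common word.
--    Hence a primitive w is fixed by no rotation αᵉ, 0 < e < |w|, and its
--    rotations αᵃw, a < |w|, are pairwise distinct; β preserves primitivity.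
--  * Orbits: ū deduplicates the n rotations of u and the n of β(u).  A
--    coincidence αᵃu = αᵇβ(u) rotates back to some αʲβ(u) = u, so for
--    primitive u: |ū| < 2n iff u ∈ Fix_j for some j < n, and αⁱβ(u) = αʲβ(u)
--    forces i = j by distinctness of the rotations of β(u).
--  * Counting: if R holds exactly when Q_j holds for a unique j < n, then
--    |filter R L| = Σ_j |filter Q_j L|.

open import Defs
open import Data.Bool using (Bool; false)
open import Data.Empty using (⊥; ⊥-elim)
open import Data.Fin using (Fin; toℕ)
open import Data.Fin.Properties using (toℕ-injective; toℕ<n)
open import Data.List using (List; []; _∷_; [_]; _++_; _∷ʳ_; map; length; reverse; take; drop; upTo; filter; deduplicate; initLast; _∷ʳ′_)
open import Data.List.Properties using (++-assoc; ++-identityʳ; ++-cancelˡ; ∷-injectiveˡ; ∷-injectiveʳ; length-++; length-map; length-upTo; length-take; length-drop; take++drop≡id; reverse-++; reverse-involutive; length-reverse; map-cong; length-filter; filter-all; filter-notAll; length-deduplicate)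
open import Data.List.Membership.Propositional using (_∈_; find; lose)
open import Data.List.Membership.Propositional.Properties using (∈-deduplicate⁺; ∈-++⁺ʳ; ∈-++⁻; ∈-map⁺; ∈-map⁻; ∈-upTo⁺; ∈-upTo⁻; ∈-filter⁻)
open import Data.List.Relation.Unary.Any using (here; there; any?)
import Data.List.Relation.Unary.Any as Any
open import Data.List.Relation.Unary.All using (All; []; _∷_; tabulate; lookup)
import Data.List.Relation.Unary.All.Properties as All
open import Data.List.Relation.Unary.AllPairs using (AllPairs; []; _∷_)
import Data.List.Relation.Unary.AllPairs.Properties as AllPairs
open import Data.List.Relation.Unary.Unique.Propositional.Properties using (upTo⁺)
open import Data.Nat using (ℕ; zero; suc; _+_; _*_; _∸_; _≤_; _<_; s≤s; z≤n; NonZero; >-nonZero)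
open import Data.Nat.DivMod using (_%_; _/_; m≡m%n+[m/n]*n; m%n<n)
open import Data.Nat.ListAction using (sum)
open import Data.Nat.Properties
open import Algebra.Properties.CommutativeSemigroup +-commutativeSemigroup using (interchange)
open import Data.Product using (Σ; ∃; _×_; _,_; proj₂)
open import Data.Sum using (inj₁; inj₂)
open import Function using (_∘_)
open import Relation.Binary using (tri<; tri≈; tri>)
open import Relation.Binary.Definitions using (DecidableEquality)
open import Relation.Binary.PropositionalEquality using (_≡_; _≢_; refl; sym; trans; cong; cong₂; subst; module ≡-Reasoning)
open import Relation.Nullary using (¬_; Dec; yes; no; ¬?)
open import Relation.Nullary.Decidable using (_×-dec_)
open import Relation.Unary using (Decidable)

open ≡-Reasoning

initLast-∷ʳ : (z : Str) (c : Bool) → initLast (z ∷ʳ c) ≡ (z ∷ʳ′ c)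
initLast-∷ʳ []      c = refl
initLast-∷ʳ (x ∷ z) c rewrite initLast-∷ʳ z c = refl

α-∷ʳ : (z : Str) (c : Bool) → α (z ∷ʳ c) ≡ c ∷ z
α-∷ʳ z c rewrite initLast-∷ʳ z c = refl

α^-+ : ∀ i j (u : Str) → (α ^[ i + j ]) u ≡ (α ^[ i ]) ((α ^[ j ]) u)
α^-+ zero    j u = refl
α^-+ (suc i) j u = cong α (α^-+ i j u)

α^-rotate : (x y : Str) → (α ^[ length y ]) (x ++ y) ≡ y ++ x
α^-rotate x []      = ++-identityʳ x
α^-rotate x (c ∷ y) = begin
  α ((α ^[ length y ]) (x ++ c ∷ y))     ≡⟨ cong (α ∘ (α ^[ length y ])) (sym (++-assoc x [ c ] y)) ⟩
  α ((α ^[ length y ]) ((x ∷ʳ c) ++ y))  ≡⟨ cong α (α^-rotate (x ∷ʳ c) y) ⟩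
  α (y ++ x ∷ʳ c)                         ≡⟨ cong α (sym (++-assoc y x [ c ])) ⟩
  α ((y ++ x) ∷ʳ c)                       ≡⟨ α-∷ʳ (y ++ x) c ⟩
  c ∷ y ++ x                              ∎

α^-length : (u : Str) → (α ^[ length u ]) u ≡ u
α^-length u = trans (α^-rotate [] u) (++-identityʳ u)

α^-multiple : ∀ q (u : Str) → (α ^[ q * length u ]) u ≡ u
α^-multiple zero    u = refl
α^-multiple (suc q) u = begin
  (α ^[ length u + q * length u ]) u          ≡⟨ α^-+ (length u) (q * length u) u ⟩
  (α ^[ length u ]) ((α ^[ q * length u ]) u) ≡⟨ cong (α ^[ length u ]) (α^-multiple q u) ⟩
  (α ^[ length u ]) u                         ≡⟨ α^-length u ⟩
  u                                           ∎

α^-mod : ∀ k (u : Str) {n} .{{_ : NonZero n}} → length u ≡ n → (α ^[ k ]) u ≡ (α ^[ k % n ]) u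
α^-mod k u {n} refl = begin
  (α ^[ k ]) u                        ≡⟨ cong (λ m → (α ^[ m ]) u) (m≡m%n+[m/n]*n k n) ⟩
  (α ^[ k % n + (k / n) * n ]) u      ≡⟨ α^-+ (k % n) ((k / n) * n) u ⟩
  (α ^[ k % n ]) ((α ^[ (k / n) * n ]) u) ≡⟨ cong (α ^[ k % n ]) (α^-multiple (k / n) u) ⟩
  (α ^[ k % n ]) u                    ∎

α^-inverse : ∀ a (u : Str) → a ≤ length u → (α ^[ length u ∸ a ]) ((α ^[ a ]) u) ≡ u
α^-inverse a u a≤n = begin
  (α ^[ length u ∸ a ]) ((α ^[ a ]) u) ≡⟨ sym (α^-+ (length u ∸ a) a u) ⟩
  (α ^[ length u ∸ a + a ]) u          ≡⟨ cong (λ k → (α ^[ k ]) u) (m∸n+n≡m a≤n) ⟩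
  (α ^[ length u ]) u                  ≡⟨ α^-length u ⟩
  u                                    ∎

^^-+ : ∀ (z : Str) a b → z ^^ (a + b) ≡ (z ^^ a) ++ (z ^^ b)
^^-+ z zero    b = refl
^^-+ z (suc a) b = trans (cong (z ++_) (^^-+ z a b)) (sym (++-assoc z (z ^^ a) (z ^^ b)))

[]^^ : ∀ a → [] ^^ a ≡ []
[]^^ zero    = refl
[]^^ (suc a) = []^^ a

power-nonempty : ∀ {x : Str} z a → x ≢ [] → x ≡ z ^^ a → z ≢ [] × 1 ≤ a
power-nonempty z       zero    x≢[] x≡ = ⊥-elim (x≢[] x≡)
power-nonempty []      (suc a) x≢[] x≡ = ⊥-elim (x≢[] (trans x≡ ([]^^ a)))
power-nonempty (c ∷ z) (suc a) x≢[] x≡ = (λ ()) , s≤s z≤n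

CommonRoot : Str → Str → Set
CommonRoot x y = Σ Str λ z → Σ ℕ λ a → Σ ℕ λ b → x ≡ z ^^ a × y ≡ z ^^ b

common-root-swap : ∀ {x y} → CommonRoot x y → CommonRoot y x
common-root-swap (z , a , b , x≡ , y≡) = z , b , a , y≡ , x≡

common-root-extend : ∀ {x y e} → CommonRoot x e → y ≡ x ++ e → CommonRoot x y
common-root-extend (z , a , b , x≡ , e≡) y≡ =
  z , a , a + b , x≡ , trans y≡ (trans (cong₂ _++_ x≡ e≡) (sym (^^-+ z a b)))

++-prefix : (a b c d : Str) → a ++ b ≡ c ++ d → length a ≤ length c → ∃ λ e → c ≡ a ++ e
++-prefix []      b c       d eq le        = c , refl
++-prefix (x ∷ a) b (y ∷ c) d eq (s≤s le) with ∷-injectiveˡ eq | ++-prefix a b c d (∷-injectiveʳ eq) le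
... | refl | e , refl = e , refl

-- The Euclidean step: if xy = yx and |x| ≤ |y| then y = xe with xe = ex.
commute-peel : (x y : Str) → x ++ y ≡ y ++ x → length x ≤ length y →
               ∃ λ e → y ≡ x ++ e × x ++ e ≡ e ++ x
commute-peel x y eq x≤y with ++-prefix x y y x eq x≤y
... | e , y≡ = e , y≡ , ++-cancelˡ x (x ++ e) (e ++ x) (begin
  x ++ (x ++ e)  ≡⟨ cong (x ++_) (sym y≡) ⟩
  x ++ y         ≡⟨ eq ⟩
  y ++ x         ≡⟨ cong (_++ x) y≡ ⟩
  (x ++ e) ++ x  ≡⟨ ++-assoc x e x ⟩
  x ++ (e ++ x)  ∎)

peel-shrinks : ∀ {fuel} (x y e : Str) → y ≡ x ++ e → 1 ≤ length x →
               length x + length y ≤ suc fuel → length x + length e ≤ fuel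
peel-shrinks x y e y≡ 1≤|x| bound =
  subst (_≤ _) (trans (cong length y≡) (length-++ x))
        (≤-pred (≤-trans (+-monoˡ-≤ (length y) 1≤|x|) bound))

-- Lyndon–Schützenberger, by recursion on |x| + |y| (bounded by the fuel).
commute⇒common-root : ∀ fuel (x y : Str) → length x + length y ≤ fuel → x ++ y ≡ y ++ x → CommonRoot x y
commute⇒common-root _    []      y       _  _  = y , 0 , 1 , refl , sym (++-identityʳ y)
commute⇒common-root _    (c ∷ x) []      _  _  = c ∷ x , 1 , 0 , sym (++-identityʳ (c ∷ x)) , refl
commute⇒common-root zero (c ∷ x) (d ∷ y) () _
commute⇒common-root (suc fuel) (c ∷ x) (d ∷ y) le eq
  with ≤-total (length (c ∷ x)) (length (d ∷ y))
... | inj₁ x≤y with commute-peel (c ∷ x) (d ∷ y) eq x≤y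
...   | e , y≡ , eq′ = common-root-extend
          (commute⇒common-root fuel (c ∷ x) e (peel-shrinks (c ∷ x) (d ∷ y) e y≡ (s≤s z≤n) le) eq′) y≡
commute⇒common-root (suc fuel) (c ∷ x) (d ∷ y) le eq
    | inj₂ y≤x with commute-peel (d ∷ y) (c ∷ x) (sym eq) y≤x
...   | e , x≡ , eq′ = common-root-swap (common-root-extend
          (commute⇒common-root fuel (d ∷ y) e (peel-shrinks (d ∷ y) (c ∷ x) e x≡ (s≤s z≤n) le′) eq′) x≡)
  where
  le′ : length (d ∷ y) + length (c ∷ x) ≤ suc fuel
  le′ = subst (_≤ suc fuel) (+-comm (length (c ∷ x)) (length (d ∷ y))) le

-- Reversal commutes with taking powers, as v commutes with its powers.
reverse-^^ : (v : Str) (k : ℕ) → reverse (v ^^ k) ≡ reverse v ^^ k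
reverse-^^ v zero    = refl
reverse-^^ v (suc k) = begin
  reverse (v ++ v ^^ k)         ≡⟨ reverse-++ v (v ^^ k) ⟩
  reverse (v ^^ k) ++ reverse v ≡⟨ cong (_++ reverse v) (reverse-^^ v k) ⟩
  reverse v ^^ k ++ reverse v   ≡⟨ power-comm (reverse v) k ⟩
  reverse v ^^ suc k            ∎
  where
  power-comm : (w : Str) (k : ℕ) → (w ^^ k) ++ w ≡ w ++ (w ^^ k)
  power-comm w zero    = sym (++-identityʳ w)
  power-comm w (suc k) = trans (++-assoc w (w ^^ k) w) (cong (w ++_) (power-comm w k))

primitive-reverse : (u : Str) → Primitive u → Primitive (reverse u)
primitive-reverse u prim v k v≢[] 2≤k u≡ =
  prim (reverse v) k (λ r → v≢[] (trans (sym (reverse-involutive v)) (cong reverse r))) 2≤k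
       (trans (sym (reverse-involutive u)) (trans (cong reverse u≡) (reverse-^^ v k)))

nonempty : (x : Str) → 0 < length x → x ≢ []
nonempty (_ ∷ _) _ ()

commuting-product-imprimitive : (x y : Str) → x ++ y ≡ y ++ x → x ≢ [] → y ≢ [] → ¬ Primitive (x ++ y)
commuting-product-imprimitive x y eq x≢[] y≢[] prim
  with commute⇒common-root _ x y ≤-refl eq
... | z , a , b , x≡ , y≡ with power-nonempty z a x≢[] x≡ | power-nonempty z b y≢[] y≡
... | z≢[] , 1≤a | _ , 1≤b =
  prim z (a + b) z≢[] (+-mono-≤ 1≤a 1≤b) (trans (cong₂ _++_ x≡ y≡) (sym (^^-+ z a b)))

-- A word fixed by αᵉ, 0 < e < |w|, splits as w = xy with x, y non-empty and
-- yx = αᵉ(xy) = xy (take |x| = |w| - e).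
rotation-fixed⇒imprimitive : (w : Str) → ∀ e → 0 < e → e < length w → (α ^[ e ]) w ≡ w → ¬ Primitive w
rotation-fixed⇒imprimitive w e 0<e e<n fixed prim =
  commuting-product-imprimitive x y (sym yx≡xy) (nonempty x |x|>0) (nonempty y |y|>0)
    (subst Primitive (sym (take++drop≡id (n ∸ e) w)) prim)
  where
  n = length w
  x = take (n ∸ e) w
  y = drop (n ∸ e) w
  |y|≡e : length y ≡ e
  |y|≡e = trans (length-drop (n ∸ e) w) (m∸[m∸n]≡n (<⇒≤ e<n))
  |x|>0 : 0 < length x
  |x|>0 = subst (0 <_) (sym (trans (length-take (n ∸ e) w) (m≤n⇒m⊓n≡m (m∸n≤m n e)))) (m<n⇒0<n∸m e<n)
  |y|>0 : 0 < length y
  |y|>0 = subst (0 <_) (sym |y|≡e) 0<e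
  yx≡xy : y ++ x ≡ x ++ y
  yx≡xy = begin
    y ++ x                     ≡⟨ sym (α^-rotate x y) ⟩
    (α ^[ length y ]) (x ++ y) ≡⟨ cong₂ (λ j v → (α ^[ j ]) v) |y|≡e (take++drop≡id (n ∸ e) w) ⟩
    (α ^[ e ]) w               ≡⟨ fixed ⟩
    w                          ≡⟨ sym (take++drop≡id (n ∸ e) w) ⟩
    x ++ y                     ∎

-- If αᵃw = αᵇw with a < b < |w| then the non-trivial rotation α^(|w|-b+a)
-- fixes w, so w is not primitive.
rotations-distinct : (w : Str) → Primitive w → ∀ {a b} → a < b → b < length w → (α ^[ a ]) w ≢ (α ^[ b ]) w
rotations-distinct w prim {a} {b} a<b b<n eq =
  rotation-fixed⇒imprimitive w (n ∸ b + a)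
    (≤-trans (m<n⇒0<n∸m b<n) (m≤m+n (n ∸ b) a))
    (subst (n ∸ b + a <_) (m∸n+n≡m (<⇒≤ b<n)) (+-monoʳ-< (n ∸ b) a<b))
    (begin
      (α ^[ n ∸ b + a ]) w           ≡⟨ α^-+ (n ∸ b) a w ⟩
      (α ^[ n ∸ b ]) ((α ^[ a ]) w)  ≡⟨ cong (α ^[ n ∸ b ]) eq ⟩
      (α ^[ n ∸ b ]) ((α ^[ b ]) w)  ≡⟨ α^-inverse b w (<⇒≤ b<n) ⟩
      w                              ∎)
    prim
  where n = length w

rotation-injective : (w : Str) → Primitive w → ∀ {a b} → a < length w → b < length w →
                     (α ^[ a ]) w ≡ (α ^[ b ]) w → a ≡ b
rotation-injective w prim {a} {b} a<n b<n eq with <-cmp a b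
... | tri< a<b _ _ = ⊥-elim (rotations-distinct w prim a<b b<n eq)
... | tri≈ _ a≡b _ = a≡b
... | tri> _ _ b<a = ⊥-elim (rotations-distinct w prim b<a a<n (sym eq))

module _ {A : Set} (_≟_ : DecidableEquality A) where

  deduplicate-unique : ∀ {xs} → AllPairs _≢_ xs → deduplicate _≟_ xs ≡ xs
  deduplicate-unique {[]}     []          = refl
  deduplicate-unique {x ∷ xs} (x∉ ∷ xs!) =
    cong (x ∷_) (trans (filter-all (¬? ∘ (x ≟_)) (All.deduplicate⁺ _≟_ x∉)) (deduplicate-unique xs!))

  deduplicate-repeat : ∀ xs ys {y} → y ∈ xs → y ∈ ys → length (deduplicate _≟_ (xs ++ ys)) < length xs + length ys
  deduplicate-repeat (x ∷ xs) ys (here refl) y∈ys = s≤s (≤-trans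
    (filter-notAll (¬? ∘ (x ≟_)) (deduplicate _≟_ (xs ++ ys))
       (Any.map (λ { refl x≢x → x≢x refl }) (∈-deduplicate⁺ _≟_ (∈-++⁺ʳ xs y∈ys))))
    (≤-trans (length-deduplicate _≟_ (xs ++ ys)) (≤-reflexive (length-++ xs))))
  deduplicate-repeat (x ∷ xs) ys (there y∈xs) y∈ys = s≤s (≤-<-trans
    (length-filter (¬? ∘ (x ≟_)) (deduplicate _≟_ (xs ++ ys)))
    (deduplicate-repeat xs ys y∈xs y∈ys))

rotations : Str → List Str
rotations u = map (λ j → (α ^[ j ]) u) (upTo (length u))

reflections : Str → List Str
reflections u = map (λ j → (α ^[ j ]) (β u)) (upTo (length u))

length-orbit-list : ∀ u → length (rotations u) + length (reflections u) ≡ 2 * length u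
length-orbit-list u = begin
  length (rotations u) + length (reflections u) ≡⟨ cong₂ _+_ (|upTo| (λ j → (α ^[ j ]) u)) (|upTo| (λ j → (α ^[ j ]) (β u))) ⟩
  length u + length u                          ≡⟨ cong (length u +_) (sym (+-identityʳ (length u))) ⟩
  2 * length u                                 ∎
  where
  |upTo| : (f : ℕ → Str) → length (map f (upTo (length u))) ≡ length u
  |upTo| f = trans (length-map f (upTo (length u))) (length-upTo (length u))

-- u ∈ Fix_j (up to the Lucas and primitivity conditions)
FixedBy : ℕ → Str → Set
FixedBy j u = (α ^[ j ]) (β u) ≡ u

-- If αʲβ(u) = u then u occurs among both the rotations and the reflections,
-- so the orbit has fewer than 2n elements.
fixed⇒symmetric : (u : Str) → ∀ j → j < length u → FixedBy j u → Symmetric u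
fixed⇒symmetric u j j<n fixed = subst (orbitSize u <_) (length-orbit-list u)
  (deduplicate-repeat _≟ˢ_ (rotations u) (reflections u)
     (∈-map⁺ (λ j → (α ^[ j ]) u) (∈-upTo⁺ (≤-<-trans z≤n j<n)))
     (subst (_∈ reflections u) fixed (∈-map⁺ (λ j → (α ^[ j ]) (β u)) (∈-upTo⁺ j<n))))

-- A coincidence αᵃu = αᵇβ(u) yields u = α^(n-a+b)β(u) = α^((n-a+b) mod n)β(u).
rotation≡reflection⇒fixed : (u : Str) → ∀ a b → a < length u → (α ^[ a ]) u ≡ (α ^[ b ]) (β u) →
                            ∃ λ j → j < length u × FixedBy j u
rotation≡reflection⇒fixed u a b a<n eq = k % n , m%n<n k n , sym (begin
  u                                    ≡⟨ sym (α^-inverse a u (<⇒≤ a<n)) ⟩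
  (α ^[ n ∸ a ]) ((α ^[ a ]) u)        ≡⟨ cong (α ^[ n ∸ a ]) eq ⟩
  (α ^[ n ∸ a ]) ((α ^[ b ]) (β u))    ≡⟨ sym (α^-+ (n ∸ a) b (β u)) ⟩
  (α ^[ k ]) (β u)                     ≡⟨ α^-mod k (β u) (length-reverse u) ⟩
  (α ^[ k % n ]) (β u)                 ∎)
  where
  n = length u
  k = n ∸ a + b
  instance
    n≢0 : NonZero n
    n≢0 = >-nonZero (≤-<-trans z≤n a<n)

-- For a primitive u in no class Fix_j, all 2n entries of the orbit list are
-- distinct: rotations of u (resp. β(u)) by primitivity, and rotations of u
-- against those of β(u) by the previous lemma.
orbit-full : (u : Str) → Primitive u → (∀ j → j < length u → ¬ FixedBy j u) → orbitSize u ≡ 2 * length u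
orbit-full u prim unfixed = begin
  orbitSize u                                   ≡⟨ cong length (deduplicate-unique _≟ˢ_ (AllPairs.++⁺ rotations! reflections! apart)) ⟩
  length (rotations u ++ reflections u)         ≡⟨ length-++ (rotations u) ⟩
  length (rotations u) + length (reflections u) ≡⟨ length-orbit-list u ⟩
  2 * length u                                  ∎
  where
  n = length u
  rotations! : AllPairs _≢_ (rotations u)
  rotations! = AllPairs.map⁺ (AllPairs.applyUpTo⁺₁ (λ j → j) n (λ i<j j<n → rotations-distinct u prim i<j j<n))
  reflections! : AllPairs _≢_ (reflections u)
  reflections! = AllPairs.map⁺ (AllPairs.applyUpTo⁺₁ (λ j → j) n (λ i<j j<n →
    rotations-distinct (β u) (primitive-reverse u prim) i<j (subst (_ <_) (sym (length-reverse u)) j<n)))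
  rotation≢reflection : ∀ {x y} → (∃ λ a → a ∈ upTo n × x ≡ (α ^[ a ]) u) →
                        (∃ λ b → b ∈ upTo n × y ≡ (α ^[ b ]) (β u)) → x ≢ y
  rotation≢reflection (a , a∈ , refl) (b , _ , refl) eq with rotation≡reflection⇒fixed u a b (∈-upTo⁻ a∈) eq
  ... | j , j<n , fixed = unfixed j j<n fixed
  apart : All (λ x → All (x ≢_) (reflections u)) (rotations u)
  apart = tabulate λ x∈ → tabulate λ y∈ → rotation≢reflection (∈-map⁻ _ x∈) (∈-map⁻ _ y∈)

symmetric⇒fixed : (u : Str) → Primitive u → Symmetric u → ∃ λ j → j < length u × FixedBy j u
symmetric⇒fixed u prim symm with any? (λ j → (α ^[ j ]) (β u) ≟ˢ u) (upTo (length u))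
... | yes found with find found
...   | j , j∈ , fixed = j , ∈-upTo⁻ j∈ , fixed
symmetric⇒fixed u prim symm | no none =
  ⊥-elim (<-irrefl (orbit-full u prim (λ j j<n fixed → none (lose (∈-upTo⁺ j<n) fixed))) symm)

-- A primitive string lies in at most one class: αⁱβ(u) = αʲβ(u) forces i = j
-- because β(u) is primitive too.
fixed-unique : (u : Str) → Primitive u → ∀ {i j} → i < length u → j < length u →
               FixedBy i u → FixedBy j u → i ≡ j
fixed-unique u prim i<n j<n fixedᵢ fixedⱼ =
  rotation-injective (β u) (primitive-reverse u prim)
    (subst (_ <_) (sym (length-reverse u)) i<n) (subst (_ <_) (sym (length-reverse u)) j<n)
    (trans fixedᵢ (sym fixedⱼ))

indicator : {P : Set} → Dec P → ℕ
indicator (yes _) = 1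
indicator (no _)  = 0

module _ {A : Set} {P : A → Set} (P? : Decidable P) where

  length-filter-∷ : ∀ x xs → length (filter P? (x ∷ xs)) ≡ indicator (P? x) + length (filter P? xs)
  length-filter-∷ x xs with P? x
  ... | yes _ = refl
  ... | no _  = refl

  filter-filter : {Q : A → Set} (Q? : Decidable Q) → ∀ xs →
                  filter Q? (filter P? xs) ≡ filter (λ x → P? x ×-dec Q? x) xs
  filter-filter Q? []       = refl
  filter-filter Q? (x ∷ xs) with P? x
  ... | no _  = filter-filter Q? xs
  ... | yes _ with Q? x
  ...   | yes _ = cong (x ∷_) (filter-filter Q? xs)
  ...   | no _  = filter-filter Q? xs

sum-map-+ : ∀ (f g : ℕ → ℕ) l → sum (map (λ j → f j + g j) l) ≡ sum (map f l) + sum (map g l)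
sum-map-+ f g []      = refl
sum-map-+ f g (j ∷ l) = trans (cong (f j + g j +_) (sum-map-+ f g l)) (interchange (f j) (g j) _ _)

sum-map-0 : ∀ (l : List ℕ) → sum (map (λ _ → 0) l) ≡ 0
sum-map-0 []      = refl
sum-map-0 (_ ∷ l) = sum-map-0 l

module _ {P : ℕ → Set} (P? : Decidable P) where

  sum-indicator-none : ∀ l → All (λ j → ¬ P j) l → sum (map (λ j → indicator (P? j)) l) ≡ 0
  sum-indicator-none []      []         = refl
  sum-indicator-none (j ∷ l) (¬pj ∷ ¬pl) with P? j
  ... | yes pj = ⊥-elim (¬pj pj)
  ... | no _   = sum-indicator-none l ¬pl

  sum-indicator-one : ∀ l k → AllPairs _≢_ l → k ∈ l → P k → (∀ j → j ∈ l → P j → j ≡ k) →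
                      sum (map (λ j → indicator (P? j)) l) ≡ 1
  sum-indicator-one (j ∷ l) k (j∉l ∷ l!) k∈ pk only-k with P? j
  ... | yes pj = cong suc (sum-indicator-none l (tabulate λ {j′} j′∈l pj′ →
          lookup j∉l j′∈l (trans (only-k j (here refl) pj) (sym (only-k j′ (there j′∈l) pj′)))))
  ... | no ¬pj with k∈
  ...   | here refl = ⊥-elim (¬pj pk)
  ...   | there k∈l = sum-indicator-one l k l! k∈l pk (λ j′ j′∈l → only-k j′ (there j′∈l))

Classifies : {A : Set} → (A → Set) → (ℕ → A → Set) → ℕ → A → Set
Classifies R Q n x = (R x → ∃ λ j → j < n × Q j x)
                   × (∀ j → j < n → Q j x → R x)
                   × (∀ i j → i < n → j < n → Q i x → Q j x → i ≡ j)

module _ {A : Set} {R : A → Set} {Q : ℕ → A → Set} (R? : Decidable R) (Q? : ∀ j → Decidable (Q j)) (n : ℕ) where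

  sum-indicator-classified : ∀ x → Classifies R Q n x →
                             sum (map (λ j → indicator (Q? j x)) (upTo n)) ≡ indicator (R? x)
  sum-indicator-classified x (complete , sound , unique) with R? x
  ... | yes r with complete r
  ...   | k , k<n , qk = sum-indicator-one (λ j → Q? j x) (upTo n) k (upTo⁺ n) (∈-upTo⁺ k<n) qk
                           (λ j j∈ qj → unique j k (∈-upTo⁻ j∈) k<n qj qk)
  sum-indicator-classified x (complete , sound , unique) | no ¬r =
    sum-indicator-none (λ j → Q? j x) (upTo n) (tabulate λ j∈ qj → ¬r (sound _ (∈-upTo⁻ j∈) qj))

  count-by-classes : ∀ L → All (Classifies R Q n) L →
                     length (filter R? L) ≡ sum (map (λ j → length (filter (Q? j) L)) (upTo n))
  count-by-classes []      []           = sym (sum-map-0 (upTo n))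
  count-by-classes (x ∷ L) (cx ∷ cL) = sym (begin
    sum (map (λ j → length (filter (Q? j) (x ∷ L))) (upTo n))
      ≡⟨ cong sum (map-cong (λ j → length-filter-∷ (Q? j) x L) (upTo n)) ⟩
    sum (map (λ j → indicator (Q? j x) + length (filter (Q? j) L)) (upTo n))
      ≡⟨ sum-map-+ (λ j → indicator (Q? j x)) (λ j → length (filter (Q? j) L)) (upTo n) ⟩
    sum (map (λ j → indicator (Q? j x)) (upTo n)) + sum (map (λ j → length (filter (Q? j) L)) (upTo n))
      ≡⟨ cong₂ _+_ (sum-indicator-classified x cx) (sym (count-by-classes L cL)) ⟩
    indicator (R? x) + length (filter R? L)
      ≡⟨ sym (length-filter-∷ R? x L) ⟩
    length (filter R? (x ∷ L)) ∎)

allStrings-length : ∀ n u → u ∈ allStrings n → length u ≡ n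
allStrings-length zero    u (here refl) = refl
allStrings-length (suc n) u u∈ with ∈-++⁻ (map (false ∷_) (allStrings n)) u∈
... | inj₁ u∈₀ with ∈-map⁻ _ u∈₀
...   | v , v∈ , refl = cong suc (allStrings-length n v v∈)
allStrings-length (suc n) u u∈ | inj₂ u∈₁ with ∈-map⁻ _ u∈₁
...   | v , v∈ , refl = cong suc (allStrings-length n v v∈)

Fix-member : ∀ n j u → u ∈ Fix n j → length u ≡ n × IsPrimLucas u × FixedBy j u
Fix-member n j u u∈ with ∈-filter⁻ (λ u → ((α ^[ j ]) (β u)) ≟ˢ u) {xs = Vp n} u∈
... | u∈Vp , fixed with ∈-filter⁻ isPrimLucas? {xs = allStrings n} u∈Vp
... | u∈all , primLucas = allStrings-length n u u∈all , primLucas , fixed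

symmetric-classified : ∀ n u → length u ≡ n →
  Classifies (λ u → IsPrimLucas u × Symmetric u) (λ j u → IsPrimLucas u × FixedBy j u) n u
symmetric-classified n u |u|≡n = complete , sound , unique
  where
  below : ∀ {j} → j < n → j < length u
  below = subst (_ <_) (sym |u|≡n)
  complete : IsPrimLucas u × Symmetric u → ∃ λ j → j < n × IsPrimLucas u × FixedBy j u
  complete (primLucas , symm) with symmetric⇒fixed u (proj₂ primLucas) symm
  ... | j , j<|u| , fixed = j , subst (j <_) |u|≡n j<|u| , primLucas , fixed
  sound : ∀ j → j < n → IsPrimLucas u × FixedBy j u → IsPrimLucas u × Symmetric u
  sound j j<n (primLucas , fixed) = primLucas , fixed⇒symmetric u j (below j<n) fixed
  unique : ∀ i j → i < n → j < n → IsPrimLucas u × FixedBy i u → IsPrimLucas u × FixedBy j u → i ≡ j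
  unique i j i<n j<n ((_ , prim) , fixedᵢ) (_ , fixedⱼ) = fixed-unique u prim (below i<n) (below j<n) fixedᵢ fixedⱼ

corollary5p5 : (n : ℕ) → 1 ≤ n →
    ((i j : Fin n) → i ≢ j → (u : Str) →
       u ∈ Fix n (toℕ i) → ¬ (u ∈ Fix n (toℕ j)))
  × (s n ≡ t n)
corollary5p5 n _ = disjoint , counting
  where
  disjoint : (i j : Fin n) → i ≢ j → (u : Str) → u ∈ Fix n (toℕ i) → ¬ (u ∈ Fix n (toℕ j))
  disjoint i j i≢j u u∈Fixᵢ u∈Fixⱼ with Fix-member n (toℕ i) u u∈Fixᵢ | Fix-member n (toℕ j) u u∈Fixⱼ
  ... | |u|≡n , (_ , prim) , fixedᵢ | _ , _ , fixedⱼ =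
    i≢j (toℕ-injective (fixed-unique u prim (below i) (below j) fixedᵢ fixedⱼ))
    where
    below : (k : Fin n) → toℕ k < length u
    below k = subst (toℕ k <_) (sym |u|≡n) (toℕ<n k)
  Q? : ∀ j → Decidable (λ u → IsPrimLucas u × FixedBy j u)
  Q? j u = isPrimLucas? u ×-dec ((α ^[ j ]) (β u) ≟ˢ u)
  counting : s n ≡ t n
  counting = begin
    s n
      ≡⟨ count-by-classes (λ u → isPrimLucas? u ×-dec symmetric? u) Q? n (allStrings n)
           (tabulate λ {u} u∈ → symmetric-classified n u (allStrings-length n u u∈)) ⟩
    sum (map (λ j → length (filter (Q? j) (allStrings n))) (upTo n))
      ≡⟨ cong sum (map-cong (λ j → cong length (sym (filter-filter isPrimLucas? _ (allStrings n)))) (upTo n)) ⟩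
    t n ∎
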